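{- Let $P$ be a weakly graded vigilant poset. Then $P$ is $(\mathbf{3+1})$-avoiding if and only if $\operatorname{trim}(P)$ is $(\mathbf{3+1})$-avoiding.
   Context: All posets are finite. A poset $P$ is weakly graded if there is a function $\operatorname{rk}:P\to\mathbb{N}$ such that $\operatorname{rk}(b)=\operatorname{rk}(a)+1$ whenever $b$ covers $a$, and such that the minimum value of $\operatorname{rk}$ on each connected component is $0$; $P(i)$ denotes the set of elements of rank $i$. An element $v$ of rank $i$ is up-seeing if every element of $P(i+1)$ covers $v$, down-seeing if $v$ covers every element of $P(i-1)$ (vacuous if that rank set is empty), and all-seeing if it is both. $P$ is vigilant if every element is up-seeing or down-seeing. The poset $\operatorname{trim}(P)$ is obtained from $P$ by deleting all all-seeing elements and then, for each rank $i$ from which at least one all-seeing element was deleted, adding a single new (unlabeled) element at rank $i$ that is greater than every element of rank $i-1$ and less than every element of rank $i+1$ (with the order closed under transitivity); the remaining elements are relabeled preserving the relative order of their labels. A poset is $(\mathbf{3+1})$-avoiding if there are no four elements $x,y,z,w$ with $x<y<z$ and $w$ incomparable to each of $x,y,z$. -}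

module Defs where

open import Data.Nat using (ℕ; zero; suc)
import Data.Nat as ℕ
open import Data.Fin using (Fin)
open import Data.Fin.Properties using (any?; all?)
import Data.Fin.Properties as FinP
open import Data.Product using (Σ; ∃; ∃-syntax; _×_; _,_)
open import Data.Sum using (_⊎_; inj₁; inj₂)
open import Relation.Nullary using (¬_; Dec)
open import Relation.Nullary.Decidable using (True; False; ¬?; _×-dec_; _→-dec_)
open import Relation.Binary using (Decidable; IsPartialOrder)
open import Relation.Binary.PropositionalEquality using (_≡_; _≢_)
open import Relation.Binary.Construct.Closure.ReflexiveTransitive using (Star)

module _ {A : Set} (_≤_ : A → A → Set) where

  Lt : A → A → Set
  Lt a b = (a ≤ b) × (a ≢ b)

  Incomparable : A → A → Set
  Incomparable a b = ¬ (a ≤ b) × ¬ (b ≤ a)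

  ThreePlusOneAvoiding : Set
  ThreePlusOneAvoiding =
    ¬ (∃[ x ] ∃[ y ] ∃[ z ] ∃[ w ]
         (Lt x y × Lt y z ×
          Incomparable w x × Incomparable w y × Incomparable w z))

record FinPoset : Set₁ where
  field
    n              : ℕ
    _≤_            : Fin n → Fin n → Set
    _≤?_           : Decidable _≤_
    isPartialOrder : IsPartialOrder _≡_ _≤_

module _ (P : FinPoset) where
  open FinPoset P

  _<_ : Fin n → Fin n → Set
  _<_ = Lt _≤_

  Covers : Fin n → Fin n → Set
  Covers b a = (a < b) × ¬ (∃[ c ] ((a < c) × (c < b)))

  Comparable : Fin n → Fin n → Set
  Comparable a b = (a ≤ b) ⊎ (b ≤ a)

  Connected : Fin n → Fin n → Set
  Connected = Star Comparable

  IsWeaklyGraded : (Fin n → ℕ) → Set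
  IsWeaklyGraded rk =
    (∀ a b → Covers b a → rk b ≡ suc (rk a)) ×
    (∀ v → ∃[ u ] (Connected v u × rk u ≡ 0))

  module _ (rk : Fin n → ℕ) where

    UpSeeing : Fin n → Set
    UpSeeing v = ∀ u → rk u ≡ suc (rk v) → Covers u v

    DownSeeing : Fin n → Set
    DownSeeing v = ∀ u → suc (rk u) ≡ rk v → Covers v u

    AllSeeing : Fin n → Set
    AllSeeing v = UpSeeing v × DownSeeing v

    Vigilant : Set
    Vigilant = ∀ v → UpSeeing v ⊎ DownSeeing v

    -- decidability (needed to build trim(P) with a well-behaved carrier)
    <? : Decidable _<_
    <? a b = (a ≤? b) ×-dec ¬? (a FinP.≟ b)

    Covers? : Decidable Covers
    Covers? b a = <? a b ×-dec ¬? (any? (λ c → <? a c ×-dec <? c b))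

    AllSeeing? : ∀ v → Dec (AllSeeing v)
    AllSeeing? v =
      all? (λ u → (rk u ℕ.≟ suc (rk v)) →-dec Covers? u v) ×-dec
      all? (λ u → (suc (rk u) ℕ.≟ rk v) →-dec Covers? v u)

    HasAllSeeingAt? : ∀ i → Dec (∃[ v ] (rk v ≡ i × AllSeeing v))
    HasAllSeeingAt? i = any? (λ v → (rk v ℕ.≟ i) ×-dec AllSeeing? v)

    -- Carrier of trim(P): the non-all-seeing elements of P (keeping their
    -- rank), together with one new element for each rank i that contained
    -- an all-seeing element.
    TrimCarrier : Set
    TrimCarrier = (Σ (Fin n) (λ v → False (AllSeeing? v)))
                ⊎ (Σ ℕ (λ i → True (HasAllSeeingAt? i)))

    trimRank : TrimCarrier → ℕ
    trimRank (inj₁ (v , _)) = rk v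
    trimRank (inj₂ (i , _)) = i

    -- Generating relations of the order of trim(P): the order of P
    -- restricted to the remaining elements, and each new element of rank i
    -- lies above every element of rank i-1 and below every element of
    -- rank i+1 (of trim(P)).
    TrimGen : TrimCarrier → TrimCarrier → Set
    TrimGen (inj₁ (a , _)) (inj₁ (b , _)) = a ≤ b
    TrimGen x (inj₂ (i , _)) = suc (trimRank x) ≡ i
    TrimGen (inj₂ (i , _)) y = trimRank y ≡ suc i

    _≤ₜ_ : TrimCarrier → TrimCarrier → Set
    _≤ₜ_ = Star TrimGen

-- Two all-seeing elements of the same rank have the same strict up- and down-sets,
-- so trim(P) is P with each class of such "twins" collapsed to one point.
-- A (3+1) in trim(P) lifts to P through a choice of representatives, which is an
-- order embedding. Conversely the collapse map preserves strict comparisons (it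
-- preserves rank), and it can only create a comparability between twins; but an
-- element incomparable to x, y, z cannot be the twin of any of them, since twins
-- have the same strict comparabilities and x < y < z.
module Submission where

open import Defs hiding (_<_; <?)
import Defs
open import Data.Nat using (ℕ; suc)
open import Data.Fin using (Fin)
open import Function.Bundles using (_⇔_; mk⇔; Equivalence)

import Data.Nat as ℕ
import Data.Nat.Properties as ℕ
open import Data.Fin.Properties using (any?; _≟_)
open import Data.Fin.Induction using (po-wellFounded; po-noetherian)
open import Data.Product using (∃-syntax; _×_; _,_; proj₁; proj₂)
open import Data.Sum using (_⊎_; inj₁; inj₂; [_,_]′)
open import Data.Bool.Properties using (T-irrelevant)
open import Function using (_∘_; flip)
open import Relation.Nullary using (¬_; Dec; yes; no; ¬?; contradiction)
open import Relation.Nullary.Decidable using (True; False; toWitness; fromWitness; toWitnessFalse; fromWitnessFalse; _×-dec_)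
open import Relation.Binary using (Decidable; IsPartialOrder; Symmetric; Transitive; Trans; _Respects₂_; _Respectsˡ_; _Respectsʳ_)
open import Relation.Binary.PropositionalEquality using (_≡_; refl; sym; trans; cong; subst₂; module ≡-Reasoning)
open import Relation.Binary.Construct.Closure.ReflexiveTransitive using (Star; ε; _◅_; _◅◅_; gmap)
open import Relation.Binary.Construct.Closure.Reflexive using (ReflClosure; [_])
import Relation.Binary.Construct.Closure.Reflexive as ReflClosure
import Relation.Binary.Construct.Closure.Reflexive.Properties as ReflClosure
import Relation.Binary.Construct.NonStrictToStrict as ToStrict
open import Induction.WellFounded using (Acc; acc)

module _ {A B : Set} {_≤ᴬ_ : A → A → Set} {_≤ᴮ_ : B → B → Set} where

  ThreePlusOneAvoiding-embedding :
    (f : B → A) → (∀ {a b} → f a ≡ f b → a ≡ b) → (∀ {a b} → a ≤ᴮ b ⇔ f a ≤ᴬ f b) →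
    ThreePlusOneAvoiding _≤ᴬ_ → ThreePlusOneAvoiding _≤ᴮ_
  ThreePlusOneAvoiding-embedding f f-injective f-order avoid
    (x , y , z , w , x<y , y<z , w∥x , w∥y , w∥z) =
    avoid (f x , f y , f z , f w , strict x<y , strict y<z ,
           incomparable w∥x , incomparable w∥y , incomparable w∥z)
    where
    strict : ∀ {a b} → Lt _≤ᴮ_ a b → Lt _≤ᴬ_ (f a) (f b)
    strict (a≤b , a≢b) = Equivalence.to f-order a≤b , a≢b ∘ f-injective

    incomparable : ∀ {a b} → Incomparable _≤ᴮ_ a b → Incomparable _≤ᴬ_ (f a) (f b)
    incomparable (a≰b , b≰a) = a≰b ∘ Equivalence.from f-order , b≰a ∘ Equivalence.from f-order

  ThreePlusOneAvoiding-collapse :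
    (f : A → B) {_≈_ : A → A → Set} → Symmetric _≈_ → Lt _≤ᴬ_ Respects₂ _≈_ →
    (∀ {a b} → Lt _≤ᴬ_ a b → Lt _≤ᴮ_ (f a) (f b)) →
    (∀ {a b} → f a ≤ᴮ f b → a ≤ᴬ b ⊎ a ≈ b) →
    ThreePlusOneAvoiding _≤ᴮ_ → ThreePlusOneAvoiding _≤ᴬ_
  ThreePlusOneAvoiding-collapse f {_≈_} ≈-sym (<-respʳ-≈ , <-respˡ-≈) f-strict f-reflects avoid
    (x , y , z , w , x<y , y<z , (w≰x , x≰w) , (w≰y , y≰w) , (w≰z , z≰w)) =
    avoid (f x , f y , f z , f w , f-strict x<y , f-strict y<z ,
           (separated w≰x (λ w≈x → w≰y (proj₁ (<-respˡ-≈ (≈-sym w≈x) x<y))) ,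
            separated x≰w (λ x≈w → w≰y (proj₁ (<-respˡ-≈ x≈w x<y)))) ,
           (separated w≰y (λ w≈y → w≰z (proj₁ (<-respˡ-≈ (≈-sym w≈y) y<z))) ,
            separated y≰w (λ y≈w → w≰z (proj₁ (<-respˡ-≈ y≈w y<z)))) ,
           (separated w≰z (λ w≈z → y≰w (proj₁ (<-respʳ-≈ (≈-sym w≈z) y<z))) ,
            separated z≰w (λ z≈w → y≰w (proj₁ (<-respʳ-≈ z≈w y<z)))))
    where
    separated : ∀ {a b} → ¬ a ≤ᴬ b → ¬ a ≈ b → ¬ f a ≤ᴮ f b
    separated a≰b a≉b = [ a≰b , a≉b ]′ ∘ f-reflects

module FinPosetProperties (P : FinPoset) where
  open FinPoset P
  open IsPartialOrder isPartialOrder using (antisym)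
    renaming (refl to ≤-refl; trans to ≤-trans; ≲-respʳ-≈ to ≤-respʳ-≡; ≲-respˡ-≈ to ≤-respˡ-≡)

  _<_ : Fin n → Fin n → Set
  _<_ = Defs._<_ P

  _⋖_ : Fin n → Fin n → Set
  a ⋖ b = Covers P b a

  _<?_ : Decidable _<_
  a <? b = (a ≤? b) ×-dec ¬? (a ≟ b)

  <-≤-trans : Trans _<_ _≤_ _<_
  <-≤-trans = ToStrict.<-≤-trans _≡_ _≤_ sym ≤-trans antisym ≤-respʳ-≡

  ≤-<-trans : Trans _≤_ _<_ _<_
  ≤-<-trans = ToStrict.≤-<-trans _≡_ _≤_ ≤-trans antisym ≤-respˡ-≡

  ⋖⇒≤ : ∀ {a b} → a ⋖ b → a ≤ b
  ⋖⇒≤ = proj₁ ∘ proj₁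

  cover-below : ∀ {a b} → a < b → ∃[ c ] (a ≤ c × c ⋖ b)
  cover-below {a} {b} = go (po-noetherian isPartialOrder a)
    where
    go : ∀ {a} → Acc (flip _<_) a → a < b → ∃[ c ] (a ≤ c × c ⋖ b)
    go {a} (acc rec) a<b with any? (λ e → (a <? e) ×-dec (e <? b))
    ... | no ∄e = a , ≤-refl , a<b , ∄e
    ... | yes (e , a<e , e<b) with go (rec a<e) e<b
    ...   | c , e≤c , c⋖b = c , ≤-trans (proj₁ a<e) e≤c , c⋖b

  ≤⇒⋖* : ∀ {a b} → a ≤ b → Star _⋖_ a b
  ≤⇒⋖* {a} {b} = go (po-wellFounded isPartialOrder b)
    where
    go : ∀ {b} → Acc _<_ b → a ≤ b → Star _⋖_ a b
    go {b} (acc rec) a≤b with a ≟ b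
    ... | yes refl = ε
    ... | no a≢b with cover-below (a≤b , a≢b)
    ...   | c , a≤c , c⋖b = go (rec (proj₁ c⋖b)) a≤c ◅◅ (c⋖b ◅ ε)

  ⋖*⇒≤ : ∀ {a b} → Star _⋖_ a b → a ≤ b
  ⋖*⇒≤ ε = ≤-refl
  ⋖*⇒≤ (a⋖c ◅ c⋖*b) = ≤-trans (⋖⇒≤ a⋖c) (⋖*⇒≤ c⋖*b)

  cover-above : ∀ {a b} → a < b → ∃[ c ] (a ⋖ c × c ≤ b)
  cover-above (a≤b , a≢b) with ≤⇒⋖* a≤b
  ... | ε = contradiction refl a≢b
  ... | a⋖c ◅ c⋖*b = _ , a⋖c , ⋖*⇒≤ c⋖*b

module RankedFinPoset (P : FinPoset) (rk : Fin (FinPoset.n P) → ℕ)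
  (rk-⋖ : ∀ a b → FinPosetProperties._⋖_ P a b → rk b ≡ suc (rk a)) where
  open FinPoset P
  open FinPosetProperties P

  rk-⋖-< : ∀ {a b} → a ⋖ b → rk a ℕ.< rk b
  rk-⋖-< a⋖b = ℕ.≤-reflexive (sym (rk-⋖ _ _ a⋖b))

  rk-⋖*-≤ : ∀ {a b} → Star _⋖_ a b → rk a ℕ.≤ rk b
  rk-⋖*-≤ ε = ℕ.≤-refl
  rk-⋖*-≤ (a⋖c ◅ c⋖*b) = ℕ.<⇒≤ (ℕ.<-≤-trans (rk-⋖-< a⋖c) (rk-⋖*-≤ c⋖*b))

  rk-strictMono : ∀ {a b} → a < b → rk a ℕ.< rk b
  rk-strictMono a<b with cover-above a<b
  ... | c , a⋖c , c≤b = ℕ.<-≤-trans (rk-⋖-< a⋖c) (rk-⋖*-≤ (≤⇒⋖* c≤b))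

  Twin : Fin n → Fin n → Set
  Twin a b = AllSeeing P rk a × AllSeeing P rk b × rk a ≡ rk b

  Twin-sym : Symmetric Twin
  Twin-sym (a-all , b-all , a≡b) = b-all , a-all , sym a≡b

  Twin-trans : Transitive Twin
  Twin-trans (a-all , _ , a≡b) (_ , c-all , b≡c) = a-all , c-all , trans a≡b b≡c

  <-respʳ-Twin : _<_ Respectsʳ Twin
  <-respʳ-Twin (_ , (_ , b-down) , a≡b) u<a with cover-below u<a
  ... | c , u≤c , c⋖a = ≤-<-trans u≤c (proj₁ (b-down c (trans (sym (rk-⋖ c _ c⋖a)) a≡b)))

  <-respˡ-Twin : _<_ Respectsˡ Twin
  <-respˡ-Twin (_ , (b-up , _) , a≡b) a<u with cover-above a<u
  ... | c , a⋖c , c≤u = <-≤-trans (proj₁ (b-up c (trans (rk-⋖ _ c a⋖c) (cong suc a≡b)))) c≤u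

  _≈_ : Fin n → Fin n → Set
  _≈_ = ReflClosure Twin

  ≈-sym : Symmetric _≈_
  ≈-sym = ReflClosure.sym Twin-sym

  ≈-trans : Transitive _≈_
  ≈-trans = ReflClosure.trans Twin-trans

  <-respʳ-≈ : _<_ Respectsʳ _≈_
  <-respʳ-≈ = ReflClosure.respʳ {P = _<_} <-respʳ-Twin

  <-respˡ-≈ : _<_ Respectsˡ _≈_
  <-respˡ-≈ = ReflClosure.respˡ {P = _<_} <-respˡ-Twin

module TrimProperties (P : FinPoset) (rk : Fin (FinPoset.n P) → ℕ)
  (rk-⋖ : ∀ a b → FinPosetProperties._⋖_ P a b → rk b ≡ suc (rk a)) where
  open FinPoset P
  open IsPartialOrder isPartialOrder using (reflexive) renaming (refl to ≤-refl; trans to ≤-trans)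
  open FinPosetProperties P
  open RankedFinPoset P rk rk-⋖

  private
    Trim = TrimCarrier P rk
    _⊑_ = _≤ₜ_ P rk

  collapse : ∀ v → Dec (AllSeeing P rk v) → Trim
  collapse v (yes v-all) = inj₂ (rk v , fromWitness (v , refl , v-all))
  collapse v (no ¬v-all) = inj₁ (v , fromWitnessFalse ¬v-all)

  toTrim : Fin n → Trim
  toTrim v = collapse v (AllSeeing? P rk v)

  fromTrim : Trim → Fin n
  fromTrim (inj₁ (v , _)) = v
  fromTrim (inj₂ (_ , q)) = proj₁ (toWitness q)

  rk-fromTrim : ∀ t → rk (fromTrim t) ≡ trimRank P rk t
  rk-fromTrim (inj₁ _) = refl
  rk-fromTrim (inj₂ (_ , q)) = proj₁ (proj₂ (toWitness q))

  fromTrim-allSeeing : ∀ {i} (q : True (HasAllSeeingAt? P rk i)) →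
    AllSeeing P rk (fromTrim (inj₂ (i , q)))
  fromTrim-allSeeing q = proj₂ (proj₂ (toWitness q))

  trimRank-toTrim : ∀ v → trimRank P rk (toTrim v) ≡ rk v
  trimRank-toTrim v with AllSeeing? P rk v
  ... | yes _ = refl
  ... | no _ = refl

  toTrim-allSeeing : ∀ {v i} (q : True (HasAllSeeingAt? P rk i)) →
    AllSeeing P rk v → rk v ≡ i → toTrim v ≡ inj₂ (i , q)
  toTrim-allSeeing {v} q v-all refl with AllSeeing? P rk v
  ... | yes _ = cong (λ q′ → inj₂ (rk v , q′)) (T-irrelevant _ q)
  ... | no ¬v-all = contradiction v-all ¬v-all

  toTrim-notAllSeeing : ∀ {v} (p : False (AllSeeing? P rk v)) → toTrim v ≡ inj₁ (v , p)
  toTrim-notAllSeeing {v} p = collapse-no (AllSeeing? P rk v)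
    where
    collapse-no : ∀ d → collapse v d ≡ inj₁ (v , p)
    collapse-no (yes v-all) = contradiction v-all (toWitnessFalse p)
    collapse-no (no _) = cong (λ p′ → inj₁ (v , p′)) (T-irrelevant _ p)

  toTrim-fromTrim : ∀ t → toTrim (fromTrim t) ≡ t
  toTrim-fromTrim (inj₁ (_ , p)) = toTrim-notAllSeeing p
  toTrim-fromTrim t@(inj₂ (_ , q)) = toTrim-allSeeing q (fromTrim-allSeeing q) (rk-fromTrim t)

  fromTrim-toTrim : ∀ v → v ≈ fromTrim (toTrim v)
  fromTrim-toTrim v with AllSeeing? P rk v
  ... | yes v-all = [ v-all , fromTrim-allSeeing _ , sym (rk-fromTrim (inj₂ _)) ]
  ... | no _ = ReflClosure.refl

  fromTrim-below-new : ∀ s {i} (q : True (HasAllSeeingAt? P rk i)) →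
    suc (trimRank P rk s) ≡ i → fromTrim s ≤ fromTrim (inj₂ (i , q))
  fromTrim-below-new s q s⋖i = ⋖⇒≤ (proj₂ (fromTrim-allSeeing q) (fromTrim s)
    (trans (cong suc (rk-fromTrim s)) (trans s⋖i (sym (rk-fromTrim (inj₂ (_ , q)))))))

  fromTrim-above-new : ∀ {i} (q : True (HasAllSeeingAt? P rk i)) t →
    trimRank P rk t ≡ suc i → fromTrim (inj₂ (i , q)) ≤ fromTrim t
  fromTrim-above-new q t i⋖t = ⋖⇒≤ (proj₁ (fromTrim-allSeeing q) (fromTrim t)
    (trans (rk-fromTrim t) (trans i⋖t (cong suc (sym (rk-fromTrim (inj₂ (_ , q))))))))

  fromTrim-gen : ∀ s t → TrimGen P rk s t → fromTrim s ≤ fromTrim t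
  fromTrim-gen (inj₁ _) (inj₁ _) a≤b = a≤b
  fromTrim-gen s@(inj₁ _) (inj₂ (_ , q)) = fromTrim-below-new s q
  fromTrim-gen s@(inj₂ _) (inj₂ (_ , q)) = fromTrim-below-new s q
  fromTrim-gen (inj₂ (_ , q)) t@(inj₁ _) = fromTrim-above-new q t

  fromTrim-mono : ∀ {s t} → s ⊑ t → fromTrim s ≤ fromTrim t
  fromTrim-mono ε = ≤-refl
  fromTrim-mono {s} (_◅_ {j = u} s→u u⊑t) =
    ≤-trans (fromTrim-gen s u s→u) (fromTrim-mono u⊑t)

  toTrim-⋖ : ∀ {a b} → a ⋖ b → TrimGen P rk (toTrim a) (toTrim b)
  toTrim-⋖ {a} {b} a⋖b with AllSeeing? P rk a | AllSeeing? P rk b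
  ... | yes _ | yes _ = sym (rk-⋖ a b a⋖b)
  ... | no _  | yes _ = sym (rk-⋖ a b a⋖b)
  ... | yes _ | no _  = rk-⋖ a b a⋖b
  ... | no _  | no _  = ⋖⇒≤ a⋖b

  toTrim-mono : ∀ {a b} → a ≤ b → toTrim a ⊑ toTrim b
  toTrim-mono = gmap toTrim toTrim-⋖ ∘ ≤⇒⋖*

  toTrim-strictMono : ∀ {a b} → a < b → Lt _⊑_ (toTrim a) (toTrim b)
  toTrim-strictMono {a} {b} a<b = toTrim-mono (proj₁ a<b) , λ a≡b →
    ℕ.<⇒≢ (rk-strictMono a<b)
      (trans (sym (trimRank-toTrim a)) (trans (cong (trimRank P rk) a≡b) (trimRank-toTrim b)))

  toTrim-reflects : ∀ {a b} → toTrim a ⊑ toTrim b → a ≤ b ⊎ Twin a b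
  toTrim-reflects {a} {b} a⊑b =
    compare (fromTrim-toTrim a) (fromTrim-toTrim b) (fromTrim-mono a⊑b)
    where
    compare : ∀ {a′ b′} → a ≈ a′ → b ≈ b′ → a′ ≤ b′ → a ≤ b ⊎ Twin a b
    compare {a′} {b′} a≈a′ b≈b′ a′≤b′ with a′ ≟ b′
    ... | yes refl =
      [ inj₁ ∘ reflexive , inj₂ ]′ (ReflClosure.toSum (≈-trans a≈a′ (≈-sym b≈b′)))
    ... | no a′≢b′ =
      inj₁ (proj₁ (<-respʳ-≈ (≈-sym b≈b′) (<-respˡ-≈ (≈-sym a≈a′) (a′≤b′ , a′≢b′))))

  fromTrim-injective : ∀ {s t} → fromTrim s ≡ fromTrim t → s ≡ t
  fromTrim-injective {s} {t} s′≡t′ = begin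
    s                   ≡⟨ toTrim-fromTrim s ⟨
    toTrim (fromTrim s) ≡⟨ cong toTrim s′≡t′ ⟩
    toTrim (fromTrim t) ≡⟨ toTrim-fromTrim t ⟩
    t                   ∎
    where open ≡-Reasoning

  fromTrim-order : ∀ {s t} → s ⊑ t ⇔ fromTrim s ≤ fromTrim t
  fromTrim-order {s} {t} = mk⇔ fromTrim-mono
    (subst₂ _⊑_ (toTrim-fromTrim s) (toTrim-fromTrim t) ∘ toTrim-mono)

proposition4p1 : (P : FinPoset) (rk : Fin (FinPoset.n P) → ℕ)
    → IsWeaklyGraded P rk → Vigilant P rk
    → ThreePlusOneAvoiding (FinPoset._≤_ P) ⇔ ThreePlusOneAvoiding (_≤ₜ_ P rk)
proposition4p1 P rk (rk-⋖ , _) _ = mk⇔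
  (ThreePlusOneAvoiding-embedding fromTrim fromTrim-injective fromTrim-order)
  (ThreePlusOneAvoiding-collapse toTrim Twin-sym (<-respʳ-Twin , <-respˡ-Twin)
    toTrim-strictMono toTrim-reflects)
  where
  open RankedFinPoset P rk rk-⋖
  open TrimProperties P rk rk-⋖
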